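{- Let $\ell\geq 3$ be odd, and let $DW_\ell$ be the double-wheel graph consisting of a cycle $C_\ell$ (the rim) together with two additional nonadjacent vertices $x,y$ (the hubs), each adjacent to every vertex of $C_\ell$. Suppose $E(DW_\ell)$ is covered by $k$ induced forests of $DW_\ell$. (i) If $\ell\geq 5$, then $k\geq 7$ and some vertex of $DW_\ell$ is contained in at least four of these forests. (ii) If $\ell\geq 7$ and a hub is contained in at least four of these forests, then $k\geq 8$.
   Context: A subgraph $H$ of $G$ is induced if for all $u,v\in V(H)$ with $uv\in E(G)$ we have $uv\in E(H)$; an induced forest is an induced subgraph that is a forest. The forests in a cover are regarded as determined by their edges, and a vertex is contained in a forest if it is incident to an edge of that forest. -}

module Defs where

open import Data.Nat using (ℕ; zero; suc; _+_)
open import Data.Fin using (Fin; toℕ; inject₁; fromℕ) renaming (zero to fzero; suc to fsuc)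
open import Data.Bool using (Bool)
open import Data.Sum using (_⊎_; inj₁; inj₂)
open import Data.Product using (Σ; ∃; _×_)
open import Data.Unit using (⊤)
open import Data.Empty using (⊥)
open import Relation.Nullary using (¬_)
open import Relation.Binary.PropositionalEquality using (_≡_)
open import Function.Definitions using (Injective)

record Graph : Set₁ where
  field
    V   : Set
    Adj : V → V → Set

open Graph public

EdgeSet : Graph → Set₁
EdgeSet G = V G → V G → Set

Contains : {G : Graph} → EdgeSet G → V G → Set
Contains {G} F v = Σ (V G) λ u → F v u

HasCycle : {G : Graph} → EdgeSet G → Set
HasCycle {G} F =
  Σ ℕ λ m → Σ (Fin (3 + m) → V G) λ c →
    Injective _≡_ _≡_ c ×
    (∀ (i : Fin (2 + m)) → F (c (inject₁ i)) (c (fsuc i))) ×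
    F (c (fromℕ (2 + m))) (c fzero)

-- F is (the edge set of) an induced forest of G: F is a symmetric set of
-- edges of G, the subgraph H with V(H) = vertices incident to F and
-- E(H) = F is induced, and H is acyclic.
IsInducedForest : (G : Graph) → EdgeSet G → Set
IsInducedForest G F =
  (∀ u v → F u v → F v u) ×
  (∀ u v → F u v → Adj G u v) ×
  (∀ u v → Contains {G} F u → Contains {G} F v → Adj G u v → F u v) ×
  ¬ HasCycle {G} F

IsInducedForestCover : (G : Graph) (k : ℕ) → (Fin k → EdgeSet G) → Set
IsInducedForestCover G k Fs =
  (∀ j → IsInducedForest G (Fs j)) ×
  (∀ u v → Adj G u v → ∃ λ j → Fs j u v)

InAtLeastFour : (G : Graph) (k : ℕ) → (Fin k → EdgeSet G) → V G → Set
InAtLeastFour G k Fs v =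
  Σ (Fin 4 → Fin k) λ f → Injective _≡_ _≡_ f × (∀ i → Contains {G} (Fs (f i)) v)

RimAdj : (ℓ : ℕ) → Fin ℓ → Fin ℓ → Set
RimAdj ℓ i j =
  (suc (toℕ i) ≡ toℕ j) ⊎ (suc (toℕ j) ≡ toℕ i) ⊎
  ((toℕ i ≡ 0) × (suc (toℕ j) ≡ ℓ)) ⊎ ((toℕ j ≡ 0) × (suc (toℕ i) ≡ ℓ))

DWAdj : (ℓ : ℕ) → Fin ℓ ⊎ Bool → Fin ℓ ⊎ Bool → Set
DWAdj ℓ (inj₁ i) (inj₁ j) = RimAdj ℓ i j
DWAdj ℓ (inj₁ i) (inj₂ b) = ⊤
DWAdj ℓ (inj₂ a) (inj₁ j) = ⊤
DWAdj ℓ (inj₂ a) (inj₂ b) = ⊥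

DW : ℕ → Graph
DW ℓ = record { V = Fin ℓ ⊎ Bool ; Adj = DWAdj ℓ }

module Submission where

-- An induced forest of DW_ℓ contains no hub together with two adjacent rim vertices (a
-- triangle) and no two hubs together with two rim vertices (a 4-cycle). So the spokes of a
-- hub at adjacent rim vertices lie in different forests, a forest through both hubs meets the
-- rim in one vertex, forests covering rim edges avoid the hubs, and, the rim being a cycle,
-- the forest covering the rim edges changes at least twice around it.
--
-- (i) As ℓ is odd, the spokes of x at some p and p + 2 lie in different forests; then the
-- spoke forests of x at p, p+1, p+2 and of y at p+3, p+4 are five distinct hub forests, and
-- two rim-edge forests make seven. A rim vertex where the rim-edge forest changes lies in two
-- rim-edge forests and in its two spoke forests, which are four forests unless both spokes
-- lie in one forest; if that happens at two such vertices, x lies in the spoke forests at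
-- these two vertices and at two further adjacent ones.
--
-- (ii) Call a rim vertex shared if its spoke to the other hub lies in one of the four forests
-- through h. Distinct shared vertices use distinct such forests, so at most four vertices are
-- shared, and when four are, the spoke forest of h at any other vertex is new. Seven
-- consecutive rim vertices contain two adjacent unshared ones, whose spoke forests to the
-- other hub are new, or four shared ones and two further ones; either way there are two hub
-- forests besides the four, and the two rim-edge forests make eight.

open import Defs
open import Data.Bool using (Bool; true; false; not)
open import Data.Bool.Properties using (not-¬)
open import Data.Empty using (⊥)
open import Data.Fin using (Fin; toℕ; fromℕ; inject₁; #_) renaming (zero to fzero; suc to fsuc)
open import Data.Fin.Properties
  using (toℕ-fromℕ<; toℕ-injective; toℕ<n; toℕ-inject₁; toℕ-fromℕ; injective⇒≤; any?)
  renaming (_≟_ to _≟ᶠ_)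
open import Data.Nat using (ℕ; zero; suc; pred; _+_; _*_; _∸_; _≤_; _<_; z≤n; s≤s; z<s; NonZero; >-nonZero)
open import Data.Nat.DivMod
open import Data.Nat.Divisibility using (∣-refl)
open import Data.Nat.Properties
open import Data.Product using (∃; _×_; _,_; proj₁; proj₂)
open import Data.Sum using (_⊎_; inj₁; inj₂)
open import Data.Sum.Properties using (inj₁-injective; inj₂-injective)
open import Data.Unit using (tt)
open import Data.Vec using (Vec; []; _∷_; lookup; map)
import Data.Vec.Relation.Unary.All as All
open All using (All; []; _∷_)
import Data.Vec.Relation.Unary.All.Properties as Allₚ
open import Data.Vec.Relation.Unary.AllPairs using ([]; _∷_; allPairs?)
import Data.Vec.Relation.Unary.AllPairs.Properties as AllPairsₚ
open import Data.Vec.Relation.Unary.Unique.Propositional using (Unique)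
import Data.Vec.Relation.Unary.Unique.Propositional.Properties as Uniqueₚ
open import Function using (_∘_)
open import Function.Definitions using (Injective)
open import Relation.Binary.Definitions using (DecidableEquality; tri<; tri≈; tri>)
open import Relation.Nullary using (¬_; Dec; yes; no; ¬?; contradiction)
open import Relation.Nullary.Decidable using (True; False; toWitness; toWitnessFalse; decidable-stable)
open import Relation.Binary.PropositionalEquality

unique⇒≤ : ∀ {n k} {js : Vec (Fin k) n} → Unique js → n ≤ k
unique⇒≤ u = injective⇒≤ (λ {i} {j} → Uniqueₚ.lookup-injective u i j)

unique? : ∀ {n k} (js : Vec (Fin k) n) → Dec (Unique js)
unique? = allPairs? (λ i j → ¬? (i ≟ᶠ j))

injective⇒surjective : ∀ {n} {g : Fin n → Fin n} → Injective _≡_ _≡_ g → ∀ t → ∃ λ i → g i ≡ t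
injective⇒surjective {n} {g} g-injective t with any? (λ i → g i ≟ᶠ t)
... | yes found = found
... | no ¬found = contradiction (injective⇒≤ extension-injective) 1+n≰n
  where
    extension : Fin (suc n) → Fin n
    extension fzero    = t
    extension (fsuc i) = g i

    extension-injective : Injective _≡_ _≡_ extension
    extension-injective {fzero}  {fzero}  _     = refl
    extension-injective {fzero}  {fsuc j} t≡gj  = contradiction (j , sym t≡gj) ¬found
    extension-injective {fsuc i} {fzero}  gi≡t  = contradiction (i , gi≡t) ¬found
    extension-injective {fsuc i} {fsuc j} gi≡gj = cong fsuc (g-injective gi≡gj)

odd⇒≡1+n+n : ∀ {m} → m % 2 ≡ 1 → m ≡ suc (m / 2 + m / 2)
odd⇒≡1+n+n {m} odd = begin
  m                 ≡⟨ m≡m%n+[m/n]*n m 2 ⟩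
  m % 2 + m / 2 * 2 ≡⟨ cong₂ _+_ odd (*-comm (m / 2) 2) ⟩
  1 + (m / 2 + (m / 2 + 0)) ≡⟨ cong (λ x → suc (m / 2 + x)) (+-identityʳ (m / 2)) ⟩
  suc (m / 2 + m / 2) ∎
  where open ≡-Reasoning

module _ {A : Set} (_≟_ : DecidableEquality A) (g : ℕ → A) where

  change-or-constant : ∀ n → (∃ λ i → g i ≢ g (suc i) × i < n) ⊎ (∀ i → i ≤ n → g i ≡ g 0)
  change-or-constant zero = inj₂ λ i i≤0 → cong g (n≤0⇒n≡0 i≤0)
  change-or-constant (suc n) with change-or-constant n
  ... | inj₁ (i , gi≢ , i<n) = inj₁ (i , gi≢ , m<n⇒m<1+n i<n)
  ... | inj₂ constant with g n ≟ g (suc n)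
  ...   | no gn≢ = inj₁ (n , gn≢ , n<1+n n)
  ...   | yes gn≡ = inj₂ constant′
    where
      constant′ : ∀ i → i ≤ suc n → g i ≡ g 0
      constant′ i i≤1+n with m≤n⇒m<n∨m≡n i≤1+n
      ... | inj₁ i<1+n = constant i (≤-pred i<1+n)
      ... | inj₂ refl  = trans (sym gn≡) (constant n ≤-refl)

  change : ∀ {n} → g 0 ≢ g n → ∃ λ i → g i ≢ g (suc i) × i < n
  change {n} g0≢gn with change-or-constant n
  ... | inj₁ found    = found
  ... | inj₂ constant = contradiction (sym (constant n ≤-refl)) g0≢gn

module _ {G : Graph} {F : EdgeSet G} (forest : IsInducedForest G F) where

  ¬contained-cycle : ∀ m (c : Fin (3 + m) → V G) → Injective _≡_ _≡_ c → (∀ i → Contains {G} F (c i)) →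
                     (∀ i → Adj G (c (inject₁ i)) (c (fsuc i))) → Adj G (c (fromℕ (2 + m))) (c fzero) → ⊥
  ¬contained-cycle m c c-injective contained path closing =
    acyclic (m , c , c-injective , (λ i → induced _ _ (contained _) (contained _) (path i))
                                 , induced _ _ (contained _) (contained _) closing)
    where
      induced = proj₁ (proj₂ (proj₂ forest))
      acyclic = proj₂ (proj₂ (proj₂ forest))

  ¬contained-polygon : ∀ {m} (cs : Vec (V G) (3 + m)) → Unique cs → All (Contains {G} F) cs →
                       (∀ i → Adj G (lookup cs (inject₁ i)) (lookup cs (fsuc i))) →
                       Adj G (lookup cs (fromℕ (2 + m))) (lookup cs fzero) → ⊥
  ¬contained-polygon {m} cs distinct contained =
    ¬contained-cycle m (lookup cs) (λ {i} {j} → Uniqueₚ.lookup-injective distinct i j) (Allₚ.lookup⁺ contained)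

module Rim (ℓ : ℕ) (3≤ℓ : 3 ≤ ℓ) where

  instance
    ℓ-nonZero : NonZero ℓ
    ℓ-nonZero = >-nonZero (≤-trans (s≤s z≤n) 3≤ℓ)

  rim : ℕ → Fin ℓ
  rim n = n mod ℓ

  toℕ-rim : ∀ n → toℕ (rim n) ≡ n % ℓ
  toℕ-rim n = toℕ-fromℕ< (m%n<n n ℓ)

  rim-toℕ : ∀ a → rim (toℕ a) ≡ a
  rim-toℕ a = toℕ-injective (trans (toℕ-rim (toℕ a)) (m<n⇒m%n≡m (toℕ<n a)))

  rim-periodic : ∀ n → rim (ℓ + n) ≡ rim n
  rim-periodic n = toℕ-injective (trans (toℕ-rim (ℓ + n))
                     (trans (%-remove-+ˡ n ∣-refl) (sym (toℕ-rim n))))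

  ℓ≢1 : ℓ ≢ 1
  ℓ≢1 ℓ≡1 = contradiction (subst (3 ≤_) ℓ≡1 3≤ℓ) λ { (s≤s ()) }

  next : Fin ℓ → Fin ℓ
  next a = rim (suc (toℕ a))

  rim-next : ∀ n → next (rim n) ≡ rim (suc n)
  rim-next n = toℕ-injective (begin
    toℕ (next (rim n))     ≡⟨ toℕ-rim (suc (toℕ (rim n))) ⟩
    suc (toℕ (rim n)) % ℓ  ≡⟨ cong (λ x → suc x % ℓ) (toℕ-rim n) ⟩
    suc (n % ℓ) % ℓ        ≡⟨ %-distribˡ-+ 1 (n % ℓ) ℓ ⟩
    (1 % ℓ + n % ℓ % ℓ) % ℓ ≡⟨ cong (λ x → (1 % ℓ + x) % ℓ) (m%n%n≡m%n n ℓ) ⟩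
    (1 % ℓ + n % ℓ) % ℓ    ≡⟨ sym (%-distribˡ-+ 1 n ℓ) ⟩
    suc n % ℓ              ≡⟨ sym (toℕ-rim (suc n)) ⟩
    toℕ (rim (suc n))      ∎)
    where open ≡-Reasoning

  RimAdj-next : ∀ a → RimAdj ℓ a (next a)
  RimAdj-next a with m≤n⇒m<n∨m≡n (toℕ<n a)
  ... | inj₁ 1+a<ℓ = inj₁ (sym (trans (toℕ-rim (suc (toℕ a))) (m<n⇒m%n≡m 1+a<ℓ)))
  ... | inj₂ 1+a≡ℓ =
    inj₂ (inj₂ (inj₂ (trans (toℕ-rim (suc (toℕ a))) (trans (cong (_% ℓ) 1+a≡ℓ) (n%n≡0 ℓ)) , 1+a≡ℓ)))

  rim-adjacent : ∀ n → RimAdj ℓ (rim n) (rim (suc n))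
  rim-adjacent n = subst (RimAdj ℓ (rim n)) (rim-next n) (RimAdj-next (rim n))

  RimAdj⇒≢ : ∀ {a b} → RimAdj ℓ a b → a ≢ b
  RimAdj⇒≢ {a} (inj₁ 1+a≡a) refl = <⇒≢ (n<1+n (toℕ a)) (sym 1+a≡a)
  RimAdj⇒≢ {a} (inj₂ (inj₁ 1+a≡a)) refl = <⇒≢ (n<1+n (toℕ a)) (sym 1+a≡a)
  RimAdj⇒≢ (inj₂ (inj₂ (inj₁ (a≡0 , 1+a≡ℓ)))) refl = ℓ≢1 (trans (sym 1+a≡ℓ) (cong suc a≡0))
  RimAdj⇒≢ (inj₂ (inj₂ (inj₂ (a≡0 , 1+a≡ℓ)))) refl = ℓ≢1 (trans (sym 1+a≡ℓ) (cong suc a≡0))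

  rim-+-≢ : ∀ m {d} → 0 < d → d < ℓ → rim m ≢ rim (m + d)
  rim-+-≢ m {d} 0<d d<ℓ rim≡ = residue-≢ (m%n<n m ℓ) r≡[r+d]%ℓ
    where
      open ≡-Reasoning

      r≡[r+d]%ℓ : m % ℓ ≡ (m % ℓ + d) % ℓ
      r≡[r+d]%ℓ = begin
        m % ℓ                 ≡⟨ sym (toℕ-rim m) ⟩
        toℕ (rim m)           ≡⟨ cong toℕ rim≡ ⟩
        toℕ (rim (m + d))     ≡⟨ toℕ-rim (m + d) ⟩
        (m + d) % ℓ           ≡⟨ %-distribˡ-+ m d ℓ ⟩
        (m % ℓ + d % ℓ) % ℓ   ≡⟨ cong (λ x → (m % ℓ + x) % ℓ) (m<n⇒m%n≡m d<ℓ) ⟩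
        (m % ℓ + d) % ℓ       ∎

      residue-≢ : ∀ {r} → r < ℓ → r ≢ (r + d) % ℓ
      residue-≢ {r} r<ℓ r≡ with r + d <? ℓ
      ... | yes r+d<ℓ = <⇒≢ (m<m+n r 0<d) (trans r≡ (m<n⇒m%n≡m r+d<ℓ))
      ... | no r+d≮ℓ = <⇒≢ d<ℓ (+-cancelˡ-≡ r d ℓ (begin
        r + d       ≡⟨ sym (m∸n+n≡m ℓ≤r+d) ⟩
        s + ℓ       ≡⟨ cong (_+ ℓ) (sym r≡s) ⟩
        r + ℓ       ∎))
        where
          ℓ≤r+d = ≮⇒≥ r+d≮ℓ
          s = r + d ∸ ℓ
          r≡s : r ≡ s
          r≡s = trans r≡ (trans (sym (m≤n⇒[n∸m]%m≡n%m ℓ≤r+d)) (m<n⇒m%n≡m s<ℓ))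
            where s<ℓ = m<n+o⇒m∸n<o (r + d) ℓ (+-mono-< r<ℓ d<ℓ)

  rim-offset-≢ : ∀ q {i j} → i < j → j < ℓ → rim (i + q) ≢ rim (j + q)
  rim-offset-≢ q {i} {j} i<j j<ℓ =
    subst (λ x → rim (i + q) ≢ rim x) (sym j+q≡i+q+[j∸i])
      (rim-+-≢ (i + q) (m<n⇒0<n∸m i<j) (≤-<-trans (m∸n≤m j i) j<ℓ))
    where
      open ≡-Reasoning
      j+q≡i+q+[j∸i] : j + q ≡ i + q + (j ∸ i)
      j+q≡i+q+[j∸i] = begin
        j + q             ≡⟨ cong (_+ q) (sym (m+[n∸m]≡n (<⇒≤ i<j))) ⟩
        i + (j ∸ i) + q   ≡⟨ +-assoc i (j ∸ i) q ⟩
        i + (j ∸ i + q)   ≡⟨ cong (i +_) (+-comm (j ∸ i) q) ⟩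
        i + (q + (j ∸ i)) ≡⟨ sym (+-assoc i q (j ∸ i)) ⟩
        i + q + (j ∸ i)   ∎

  rim-offset-injective : ∀ q {i j} → i < ℓ → j < ℓ → rim (i + q) ≡ rim (j + q) → i ≡ j
  rim-offset-injective q {i} {j} i<ℓ j<ℓ rim≡ with <-cmp i j
  ... | tri< i<j _ _ = contradiction rim≡ (rim-offset-≢ q i<j j<ℓ)
  ... | tri≈ _ i≡j _ = i≡j
  ... | tri> _ _ j<i = contradiction (sym rim≡) (rim-offset-≢ q j<i i<ℓ)

  window : ∀ {n} → ℕ → Fin n → Fin ℓ
  window q i = rim (toℕ i + q)

  window-injective : ∀ {n} → n ≤ ℓ → ∀ q → Injective _≡_ _≡_ (window {n} q)
  window-injective n≤ℓ q {i} {j} w≡ =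
    toℕ-injective (rim-offset-injective q (<-≤-trans (toℕ<n i) n≤ℓ) (<-≤-trans (toℕ<n j) n≤ℓ) w≡)

  window-≢ : ∀ {n} → n ≤ ℓ → ∀ q (i j : Fin n) → {False (i ≟ᶠ j)} → window q i ≢ window q j
  window-≢ n≤ℓ q i j {i≢j} = toWitnessFalse i≢j ∘ window-injective n≤ℓ q

  Avoids : ℕ → Fin ℓ → Fin ℓ → Set
  Avoids n a b = rim n ≢ a × rim n ≢ b

  ∃adjacent-avoiding : 5 ≤ ℓ → ∀ a b → ∃ λ n → Avoids n a b × Avoids (suc n) a b
  ∃adjacent-avoiding 5≤ℓ a b =
    subst (λ a → ∃ λ n → Avoids n a b × Avoids (suc n) a b) (rim-toℕ a)
      (from (b ≟ᶠ w (# 1)) (b ≟ᶠ w (# 2)))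
    where
      w = window {5} (toℕ a)
      w≢ = window-≢ 5≤ℓ (toℕ a)

      from : Dec (b ≡ w (# 1)) → Dec (b ≡ w (# 2)) → ∃ λ n → Avoids n (w (# 0)) b × Avoids (suc n) (w (# 0)) b
      from (yes b≡w₁) _ =
        3 + toℕ a , (w≢ (# 3) (# 0) , w≢ (# 3) (# 1) ∘ (λ e → trans e b≡w₁))
                  , (w≢ (# 4) (# 0) , w≢ (# 4) (# 1) ∘ (λ e → trans e b≡w₁))
      from (no _) (yes b≡w₂) =
        3 + toℕ a , (w≢ (# 3) (# 0) , w≢ (# 3) (# 2) ∘ (λ e → trans e b≡w₂))
                  , (w≢ (# 4) (# 0) , w≢ (# 4) (# 2) ∘ (λ e → trans e b≡w₂))
      from (no b≢w₁) (no b≢w₂) =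
        1 + toℕ a , (w≢ (# 1) (# 0) , ≢-sym b≢w₁) , (w≢ (# 2) (# 0) , ≢-sym b≢w₂)

module Cover (ℓ : ℕ) (3≤ℓ : 3 ≤ ℓ) {k : ℕ} {Fs : Fin k → EdgeSet (DW ℓ)}
             (cover : IsInducedForestCover (DW ℓ) k Fs) where

  open Rim ℓ 3≤ℓ

  _∋_ : Fin k → Fin ℓ ⊎ Bool → Set
  j ∋ v = Contains {DW ℓ} (Fs j) v

  ∋-left : ∀ {j u v} → Fs j u v → j ∋ u
  ∋-left {v = v} uv = v , uv

  ∋-right : ∀ {j u v} → Fs j u v → j ∋ v
  ∋-right {j} {u} {v} uv = u , proj₁ (proj₁ cover j) u v uv

  ¬hub-rimEdge : ∀ {j h a b} → RimAdj ℓ a b → j ∋ inj₂ h → j ∋ inj₁ a → j ∋ inj₁ b → ⊥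
  ¬hub-rimEdge {j} {h} {a} {b} a~b j∋h j∋a j∋b =
    ¬contained-polygon (proj₁ cover j) triangle distinct (j∋h ∷ j∋a ∷ j∋b ∷ []) sides tt
    where
      triangle : Vec (Fin ℓ ⊎ Bool) 3
      triangle = inj₂ h ∷ inj₁ a ∷ inj₁ b ∷ []
      distinct : Unique triangle
      distinct = ((λ ()) ∷ (λ ()) ∷ []) ∷ (RimAdj⇒≢ a~b ∘ inj₁-injective ∷ []) ∷ [] ∷ []
      sides : ∀ i → DWAdj ℓ (lookup triangle (inject₁ i)) (lookup triangle (fsuc i))
      sides fzero        = tt
      sides (fsuc fzero) = a~b

  ¬hubs-twoRim : ∀ {j h h′ a b} → h ≢ h′ → a ≢ b →
                 j ∋ inj₂ h → j ∋ inj₂ h′ → j ∋ inj₁ a → j ∋ inj₁ b → ⊥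
  ¬hubs-twoRim {j} {h} {h′} {a} {b} h≢h′ a≢b j∋h j∋h′ j∋a j∋b =
    ¬contained-polygon (proj₁ cover j) square distinct (j∋h ∷ j∋a ∷ j∋h′ ∷ j∋b ∷ []) sides tt
    where
      square : Vec (Fin ℓ ⊎ Bool) 4
      square = inj₂ h ∷ inj₁ a ∷ inj₂ h′ ∷ inj₁ b ∷ []
      distinct : Unique square
      distinct = ((λ ()) ∷ h≢h′ ∘ inj₂-injective ∷ (λ ()) ∷ [])
               ∷ ((λ ()) ∷ a≢b ∘ inj₁-injective ∷ []) ∷ ((λ ()) ∷ []) ∷ [] ∷ []
      sides : ∀ i → DWAdj ℓ (lookup square (inject₁ i)) (lookup square (fsuc i))
      sides fzero               = tt
      sides (fsuc fzero)        = tt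
      sides (fsuc (fsuc fzero)) = tt

  bothHubs⇒sameRim : ∀ {j h h′ a b} → h ≢ h′ →
                     j ∋ inj₂ h → j ∋ inj₂ h′ → j ∋ inj₁ a → j ∋ inj₁ b → a ≡ b
  bothHubs⇒sameRim {a = a} {b} h≢h′ j∋h j∋h′ j∋a j∋b =
    decidable-stable (a ≟ᶠ b) λ a≢b → ¬hubs-twoRim h≢h′ a≢b j∋h j∋h′ j∋a j∋b

  spokeEdge : ∀ h a → ∃ λ j → Fs j (inj₁ a) (inj₂ h)
  spokeEdge h a = proj₂ cover (inj₁ a) (inj₂ h) tt

  spoke : Bool → Fin ℓ → Fin k
  spoke h a = proj₁ (spokeEdge h a)

  spoke∋rim : ∀ {h a} → spoke h a ∋ inj₁ a
  spoke∋rim {h} {a} = ∋-left (proj₂ (spokeEdge h a))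

  spoke∋hub : ∀ {h a} → spoke h a ∋ inj₂ h
  spoke∋hub {h} {a} = ∋-right (proj₂ (spokeEdge h a))

  rimEdgeAt-edge : ∀ a → ∃ λ j → Fs j (inj₁ a) (inj₁ (next a))
  rimEdgeAt-edge a = proj₂ cover (inj₁ a) (inj₁ (next a)) (RimAdj-next a)

  rimEdgeAt : Fin ℓ → Fin k
  rimEdgeAt a = proj₁ (rimEdgeAt-edge a)

  rimEdge : ℕ → Fin k
  rimEdge p = rimEdgeAt (rim p)

  rimEdge∋ : ∀ p → rimEdge p ∋ inj₁ (rim p)
  rimEdge∋ p = ∋-left (proj₂ (rimEdgeAt-edge (rim p)))

  rimEdge∋next : ∀ p → rimEdge p ∋ inj₁ (rim (suc p))
  rimEdge∋next p = subst (λ a → rimEdge p ∋ inj₁ a) (rim-next p) (∋-right (proj₂ (rimEdgeAt-edge (rim p))))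

  spoke-≢-adjacent : ∀ {h a b} → RimAdj ℓ a b → spoke h a ≢ spoke h b
  spoke-≢-adjacent a~b ≡b = ¬hub-rimEdge a~b spoke∋hub spoke∋rim (subst (_∋ _) (sym ≡b) spoke∋rim)

  spoke-≢-other : ∀ {h h′ a b} → h ≢ h′ → a ≢ b → spoke h a ≢ spoke h′ b
  spoke-≢-other h≢h′ a≢b ≡b =
    ¬hubs-twoRim h≢h′ a≢b spoke∋hub (subst (_∋ _) (sym ≡b) spoke∋hub)
                          spoke∋rim (subst (_∋ _) (sym ≡b) spoke∋rim)

  rimEdge-≢-hub : ∀ {p j h} → j ∋ inj₂ h → rimEdge p ≢ j
  rimEdge-≢-hub {p} j∋h ≡j =
    ¬hub-rimEdge (rim-adjacent p) (subst (_∋ _) (sym ≡j) j∋h) (rimEdge∋ p) (rimEdge∋next p)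

  ¬rimEdge-constant : ∀ m → 3 + m ≡ ℓ → (∀ i → i ≤ 2 + m → rimEdge i ≡ rimEdge 0) → ⊥
  ¬rimEdge-constant m 3+m≡ℓ constant =
    ¬contained-cycle (proj₁ cover (rimEdge 0)) m (inj₁ ∘ window 0)
      (window-injective (≤-reflexive 3+m≡ℓ) 0 ∘ inj₁-injective) contained path closing
    where
      contained : ∀ i → rimEdge 0 ∋ inj₁ (window 0 i)
      contained i = subst (_∋ inj₁ (window 0 i)) (constant (toℕ i + 0) i+0≤2+m) (rimEdge∋ (toℕ i + 0))
        where i+0≤2+m = subst (_≤ 2 + m) (sym (+-identityʳ (toℕ i))) (≤-pred (toℕ<n i))
      path : ∀ i → RimAdj ℓ (window 0 (inject₁ i)) (window 0 (fsuc i))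
      path i = subst (λ x → RimAdj ℓ (rim (x + 0)) (window 0 (fsuc i))) (sym (toℕ-inject₁ i))
                 (rim-adjacent (toℕ i + 0))
      closing : RimAdj ℓ (window 0 (fromℕ (2 + m))) (window {3 + m} 0 fzero)
      closing = subst₂ (λ x y → RimAdj ℓ (rim (x + 0)) y) (sym (toℕ-fromℕ (2 + m)))
                  (trans (cong (λ x → rim (x + 0)) 3+m≡ℓ) (rim-periodic 0)) (rim-adjacent (2 + m + 0))

  ∃rimEdge-change : ∃ λ r → rimEdge r ≢ rimEdge (suc r)
  ∃rimEdge-change with change-or-constant _≟ᶠ_ rimEdge (2 + (ℓ ∸ 3))
  ... | inj₁ (r , r≢ , _) = r , r≢
  ... | inj₂ constant     = contradiction constant (¬rimEdge-constant (ℓ ∸ 3) (m+[n∸m]≡n 3≤ℓ))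

  ∃another-rimEdge-change : ∀ {r} → rimEdge r ≢ rimEdge (suc r) →
                            ∃ λ s → rimEdge (s + r) ≢ rimEdge (suc s + r) × 0 < s × s < ℓ
  ∃another-rimEdge-change {r} r≢ with change _≟ᶠ_ (λ i → rimEdge (suc i + r)) {pred ℓ}
    (λ e → r≢ (sym (trans e (cong rimEdgeAt (trans (cong (λ x → rim (x + r)) (suc-pred ℓ)) (rim-periodic r))))))
  ... | i , i≢ , i<pred-ℓ = suc i , i≢ , z<s , subst (suc i <_) (suc-pred ℓ) (s≤s i<pred-ℓ)

  ∃spoke-change : ∀ h {n} → ℓ ≡ suc (n + n) → ∃ λ p → spoke h (rim p) ≢ spoke h (rim (2 + p))
  ∃spoke-change h {n} ℓ≡1+n+n
    with change _≟ᶠ_ (λ i → spoke h (rim (i + i))) {n} (≢-sym (spoke-≢-adjacent closing))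
    where
      closing : RimAdj ℓ (rim (n + n)) (rim 0)
      closing = subst (RimAdj ℓ (rim (n + n)))
                  (trans (cong rim (trans (sym ℓ≡1+n+n) (sym (+-identityʳ ℓ)))) (rim-periodic 0))
                  (rim-adjacent (n + n))
  ... | i , i≢ , _ = i + i , subst (λ x → spoke h (rim (i + i)) ≢ spoke h (rim x)) (cong suc (+-suc i i)) i≢

  HubForest : Fin k → Set
  HubForest j = ∃ λ h → j ∋ inj₂ h

  hubForests⇒2+n≤k : ∀ {n} {js : Vec (Fin k) n} → Unique js → All HubForest js → 2 + n ≤ k
  hubForests⇒2+n≤k {js = js} distinct hubs with ∃rimEdge-change
  ... | r , r≢ = unique⇒≤ ((r≢ ∷ avoids r) ∷ avoids (suc r) ∷ distinct)
    where
      avoids : ∀ p → All (rimEdge p ≢_) js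
      avoids p = All.map (λ (_ , j∋h) → rimEdge-≢-hub j∋h) hubs

  inFour : ∀ {v} (js : Vec (Fin k) 4) → Unique js → All (_∋ v) js → InAtLeastFour (DW ℓ) k Fs v
  inFour js distinct contained =
    lookup js , (λ {i} {j} → Uniqueₚ.lookup-injective distinct i j) , Allₚ.lookup⁺ contained

  Double : Fin ℓ → Set
  Double b = spoke true b ≡ spoke false b

  Double? : ∀ b → Dec (Double b)
  Double? b = spoke true b ≟ᶠ spoke false b

  Double⇒spoke-≢ : ∀ {a b} → Double b → a ≢ b → spoke true a ≢ spoke true b
  Double⇒spoke-≢ {a} {b} double a≢b a≡b =
    a≢b (bothHubs⇒sameRim (λ ()) (spoke∋hub {true} {b}) (subst (_∋ inj₂ false) (sym double) spoke∋hub)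
           (subst (_∋ inj₁ a) a≡b spoke∋rim) spoke∋rim)

  breakVertex-inFour : ∀ p → rimEdge p ≢ rimEdge (suc p) → ¬ Double (rim (suc p)) →
                       InAtLeastFour (DW ℓ) k Fs (inj₁ (rim (suc p)))
  breakVertex-inFour p p≢ ¬double =
    inFour (rimEdge p ∷ rimEdge (suc p) ∷ spoke true b ∷ spoke false b ∷ [])
      ((p≢ ∷ rimEdge-≢-hub spoke∋hub ∷ rimEdge-≢-hub spoke∋hub ∷ [])
       ∷ (rimEdge-≢-hub spoke∋hub ∷ rimEdge-≢-hub spoke∋hub ∷ []) ∷ (¬double ∷ []) ∷ [] ∷ [])
      (rimEdge∋next p ∷ rimEdge∋ (suc p) ∷ spoke∋rim ∷ spoke∋rim ∷ [])
    where b = rim (suc p)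

  module _ (5≤ℓ : 5 ≤ ℓ) where

    7≤k : ∀ {n} → ℓ ≡ suc (n + n) → 7 ≤ k
    7≤k {n} ℓ≡1+n+n with ∃spoke-change true {n} ℓ≡1+n+n
    ... | p , X₀≢X₂ =
      hubForests⇒2+n≤k distinct (hub true ∷ hub true ∷ hub true ∷ hub false ∷ hub false ∷ [])
      where
        w = window {5} p
        X = spoke true
        Y = spoke false

        hub : ∀ h {a} → HubForest (spoke h a)
        hub h = h , spoke∋hub

        X≢Y : ∀ i j → {False (i ≟ᶠ j)} → X (w i) ≢ Y (w j)
        X≢Y i j {i≢j} = spoke-≢-other (λ ()) (window-≢ 5≤ℓ p i j {i≢j})

        distinct : Unique (X (w (# 0)) ∷ X (w (# 1)) ∷ X (w (# 2)) ∷ Y (w (# 3)) ∷ Y (w (# 4)) ∷ [])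
        distinct = (spoke-≢-adjacent (rim-adjacent p) ∷ X₀≢X₂ ∷ X≢Y (# 0) (# 3) ∷ X≢Y (# 0) (# 4) ∷ [])
                 ∷ (spoke-≢-adjacent (rim-adjacent (1 + p)) ∷ X≢Y (# 1) (# 3) ∷ X≢Y (# 1) (# 4) ∷ [])
                 ∷ (X≢Y (# 2) (# 3) ∷ X≢Y (# 2) (# 4) ∷ [])
                 ∷ (spoke-≢-adjacent (rim-adjacent (3 + p)) ∷ [])
                 ∷ [] ∷ []

    doubles⇒hubInFour : ∀ {b b₂} → Double b → Double b₂ → b ≢ b₂ → InAtLeastFour (DW ℓ) k Fs (inj₂ true)
    doubles⇒hubInFour {b} {b₂} d d₂ b≢b₂ with ∃adjacent-avoiding 5≤ℓ b b₂
    ... | c , (c≢b , c≢b₂) , (c′≢b , c′≢b₂) =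
      inFour (spoke true b ∷ spoke true b₂ ∷ spoke true (rim c) ∷ spoke true (rim (suc c)) ∷ [])
        ((Double⇒spoke-≢ d₂ b≢b₂ ∷ ≢-sym (Double⇒spoke-≢ d c≢b) ∷ ≢-sym (Double⇒spoke-≢ d c′≢b) ∷ [])
         ∷ (≢-sym (Double⇒spoke-≢ d₂ c≢b₂) ∷ ≢-sym (Double⇒spoke-≢ d₂ c′≢b₂) ∷ [])
         ∷ (spoke-≢-adjacent (rim-adjacent c) ∷ []) ∷ [] ∷ [])
        (spoke∋hub ∷ spoke∋hub ∷ spoke∋hub ∷ spoke∋hub ∷ [])

    ∃inFour : ∃ λ v → InAtLeastFour (DW ℓ) k Fs v
    ∃inFour with ∃rimEdge-change
    ... | r , r≢ with Double? (rim (suc r))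
    ...   | no ¬d = inj₁ (rim (suc r)) , breakVertex-inFour r r≢ ¬d
    ...   | yes d with ∃another-rimEdge-change r≢
    ...     | s , s≢ , 0<s , s<ℓ with Double? (rim (suc s + r))
    ...       | no ¬d₂ = inj₁ (rim (suc s + r)) , breakVertex-inFour (s + r) s≢ ¬d₂
    ...       | yes d₂ = inj₂ true , doubles⇒hubInFour d d₂
                           (subst (λ x → rim (suc r) ≢ rim (suc x)) (+-comm r s) (rim-+-≢ (suc r) 0<s s<ℓ))

  module _ (7≤ℓ : 7 ≤ ℓ) (h : Bool) (four : InAtLeastFour (DW ℓ) k Fs (inj₂ h)) where

    f : Fin 4 → Fin k
    f = proj₁ four

    f∋h : ∀ t → f t ∋ inj₂ h
    f∋h = proj₂ (proj₂ four)

    h′ : Bool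
    h′ = not h

    h≢h′ : h ≢ h′
    h≢h′ = not-¬ refl

    Shared : Fin ℓ → Set
    Shared c = ∃ λ t → spoke h′ c ≡ f t

    shared? : ∀ c → Dec (Shared c)
    shared? c = any? (λ t → spoke h′ c ≟ᶠ f t)

    sharedForest⇒sameRim : ∀ {c c′ t} → spoke h′ c ≡ f t → f t ∋ inj₁ c′ → c ≡ c′
    sharedForest⇒sameRim {c} {t = t} c≡t t∋c′ =
      bothHubs⇒sameRim h≢h′ (f∋h t) (subst (_∋ inj₂ h′) c≡t spoke∋hub)
                            (subst (_∋ inj₁ c) c≡t spoke∋rim) t∋c′

    sharedIndex : ∀ {n} {cs : Vec (Fin ℓ) n} → All Shared cs → Fin n → Fin 4
    sharedIndex shared i = proj₁ (Allₚ.lookup⁺ shared i)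

    sharedIndex-injective : ∀ {n} {cs : Vec (Fin ℓ) n} → Unique cs → (shared : All Shared cs) →
                            Injective _≡_ _≡_ (sharedIndex shared)
    sharedIndex-injective {cs = cs} distinct shared {i} {j} tᵢ≡tⱼ =
      Uniqueₚ.lookup-injective distinct i j (sharedForest⇒sameRim (proj₂ (Allₚ.lookup⁺ shared i))
        (subst (λ t → f t ∋ inj₁ (lookup cs j)) (sym tᵢ≡tⱼ)
          (subst (_∋ inj₁ (lookup cs j)) (proj₂ (Allₚ.lookup⁺ shared j)) spoke∋rim)))

    shared≤4 : ∀ {n} {cs : Vec (Fin ℓ) n} → Unique cs → All Shared cs → n ≤ 4
    shared≤4 distinct shared = injective⇒≤ (sharedIndex-injective distinct shared)

    -- Four shared vertices use up all four forests through h, and each of these forests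
    -- meets the rim only in its shared vertex.
    fourShared⇒spoke-≢ : ∀ {bs : Vec (Fin ℓ) 4} {c} → Unique bs → All Shared bs → All (c ≢_) bs →
                         ∀ t → spoke h c ≢ f t
    fourShared⇒spoke-≢ {bs} {c} distinct shared c∉bs t c≡t
      with injective⇒surjective (sharedIndex-injective distinct shared) t
    ... | i , tᵢ≡t =
      Allₚ.lookup⁺ c∉bs i (sym (sharedForest⇒sameRim bᵢ≡t (subst (_∋ inj₁ c) c≡t spoke∋rim)))
      where
        bᵢ≡t : spoke h′ (lookup bs i) ≡ f t
        bᵢ≡t = subst (λ t → spoke h′ (lookup bs i) ≡ f t) tᵢ≡t (proj₂ (Allₚ.lookup⁺ shared i))

    twoMoreHubForests⇒8≤k : ∀ {a b} → a ≢ b → HubForest a → HubForest b →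
                            (∀ t → f t ≢ a) → (∀ t → f t ≢ b) → 8 ≤ k
    twoMoreHubForests⇒8≤k a≢b a-hub b-hub f≢a f≢b =
      hubForests⇒2+n≤k
        (AllPairsₚ.++⁺ (Uniqueₚ.tabulate⁺ (proj₁ (proj₂ four))) ((a≢b ∷ []) ∷ [] ∷ [])
                       (Allₚ.tabulate⁺ λ t → f≢a t ∷ f≢b t ∷ []))
        (Allₚ.++⁺ (Allₚ.tabulate⁺ λ t → h , f∋h t) (a-hub ∷ b-hub ∷ []))

    adjacentUnshared⇒8≤k : ∀ {c c′} → RimAdj ℓ c c′ → ¬ Shared c → ¬ Shared c′ → 8 ≤ k
    adjacentUnshared⇒8≤k c~c′ ¬shared ¬shared′ =
      twoMoreHubForests⇒8≤k (spoke-≢-adjacent c~c′) (h′ , spoke∋hub) (h′ , spoke∋hub)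
        (λ t t≡c → ¬shared (t , sym t≡c)) (λ t t≡c′ → ¬shared′ (t , sym t≡c′))

    fourShared⇒8≤k : ∀ {bs : Vec (Fin ℓ) 4} {u c} → Unique bs → All Shared bs →
                     ¬ Shared u → c ≢ u → All (c ≢_) bs → 8 ≤ k
    fourShared⇒8≤k distinct shared ¬shared c≢u c∉bs =
      twoMoreHubForests⇒8≤k (spoke-≢-other h≢h′ c≢u) (h , spoke∋hub) (h′ , spoke∋hub)
        (λ t t≡c → fourShared⇒spoke-≢ distinct shared c∉bs t (sym t≡c))
        (λ t t≡u → ¬shared (t , sym t≡u))

    windowShared⇒8≤k : ∀ q (bs : Vec (Fin 7) 4) (u c : Fin 7) → {True (unique? (c ∷ u ∷ bs))} →
                       All Shared (map (window q) bs) → ¬ Shared (window q u) → 8 ≤ k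
    windowShared⇒8≤k q bs u c {distinct} shared ¬shared
      with Uniqueₚ.map⁺ (window-injective 7≤ℓ q) (toWitness distinct)
    ... | (c≢u ∷ c∉bs) ∷ (_ ∷ bs-distinct) = fourShared⇒8≤k bs-distinct shared ¬shared c≢u c∉bs

    ∃unshared : ∃ λ q → ¬ Shared (rim (suc q))
    ∃unshared with any? (λ i → ¬? (shared? (window {5} 1 i)))
    ... | yes (i , ¬shared) = toℕ i , subst (λ x → ¬ Shared (rim x)) (+-comm (toℕ i) 1) ¬shared
    ... | no ¬∃ = contradiction (shared≤4 (Uniqueₚ.tabulate⁺ (window-injective 5≤ℓ 1)) all-shared) 1+n≰n
      where
        5≤ℓ = ≤-trans (m≤m+n 5 2) 7≤ℓ
        all-shared = Allₚ.tabulate⁺ λ i → decidable-stable (shared? (window 1 i)) (¬∃ ∘ (i ,_))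

    -- Position 1 of the window is unshared. Unless two adjacent positions are unshared,
    -- positions 0 and 2 and one position of each of {3, 4} and {5, 6} are shared.
    8≤k : 8 ≤ k
    8≤k with ∃unshared
    ... | q , ¬s₁ with shared? (rim q) | shared? (rim (2 + q))
    ...   | no ¬s₀ | _      = adjacentUnshared⇒8≤k (rim-adjacent q) ¬s₀ ¬s₁
    ...   | yes _  | no ¬s₂ = adjacentUnshared⇒8≤k (rim-adjacent (1 + q)) ¬s₁ ¬s₂
    ...   | yes s₀ | yes s₂
      with shared? (rim (3 + q)) | shared? (rim (4 + q)) | shared? (rim (5 + q)) | shared? (rim (6 + q))
    ... | no ¬s₃ | no ¬s₄ | _      | _      = adjacentUnshared⇒8≤k (rim-adjacent (3 + q)) ¬s₃ ¬s₄
    ... | _      | _      | no ¬s₅ | no ¬s₆ = adjacentUnshared⇒8≤k (rim-adjacent (5 + q)) ¬s₅ ¬s₆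
    ... | yes s₃ | _      | yes s₅ | _      =
        windowShared⇒8≤k q (# 0 ∷ # 2 ∷ # 3 ∷ # 5 ∷ []) (# 1) (# 4) (s₀ ∷ s₂ ∷ s₃ ∷ s₅ ∷ []) ¬s₁
    ... | yes s₃ | _      | no _   | yes s₆ =
        windowShared⇒8≤k q (# 0 ∷ # 2 ∷ # 3 ∷ # 6 ∷ []) (# 1) (# 4) (s₀ ∷ s₂ ∷ s₃ ∷ s₆ ∷ []) ¬s₁
    ... | no _   | yes s₄ | yes s₅ | _      =
        windowShared⇒8≤k q (# 0 ∷ # 2 ∷ # 4 ∷ # 5 ∷ []) (# 1) (# 3) (s₀ ∷ s₂ ∷ s₄ ∷ s₅ ∷ []) ¬s₁
    ... | no _   | yes s₄ | no _   | yes s₆ =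
        windowShared⇒8≤k q (# 0 ∷ # 2 ∷ # 4 ∷ # 6 ∷ []) (# 1) (# 3) (s₀ ∷ s₂ ∷ s₄ ∷ s₆ ∷ []) ¬s₁

lemma2 : (ℓ : ℕ) → ℓ % 2 ≡ 1 → 3 ≤ ℓ →
         (k : ℕ) (Fs : Fin k → EdgeSet (DW ℓ)) → IsInducedForestCover (DW ℓ) k Fs →
         (5 ≤ ℓ → 7 ≤ k × ∃ λ v → InAtLeastFour (DW ℓ) k Fs v) ×
         (7 ≤ ℓ → (h : Bool) → InAtLeastFour (DW ℓ) k Fs (inj₂ h) → 8 ≤ k)
lemma2 ℓ odd 3≤ℓ k Fs cover =
  (λ 5≤ℓ → 7≤k 5≤ℓ {ℓ / 2} (odd⇒≡1+n+n odd) , ∃inFour 5≤ℓ) , 8≤k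
  where open Cover ℓ 3≤ℓ cover
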